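{- Let $S$ be a finite non-empty set, $p:2^S\to\mathbb{Z}\cup\{ -\infty\}$ a supermodular function with $p(\emptyset)=0$ and $p(S)$ finite, and $B=\{x\in\mathbb{R}^S:\widetilde x(S)=p(S),\ \widetilde x(Z)\ge p(Z)\ \forall Z\subseteq S\}$. Let $\{S_1,\dots,S_q\}$, $C_1\subset\cdots\subset C_q=S$ and $\beta_1>\cdots>\beta_q$ be the canonical partition, canonical chain and essential value-sequence defined below. For $i=1,\dots,q$ let $p_i(X)=p(X\cup C_{i-1})-p(C_{i-1})$ for $X\subseteq S_i$, let $B_i=\{x\in\mathbb{R}^{S_i}:\widetilde x(S_i)=p_i(S_i),\ \widetilde x(Z)\ge p_i(Z)\ \forall Z\subseteq S_i\}$ and $T_i=\{x\in\mathbb{R}^{S_i}:\beta_i-1\le x(s)\le\beta_i\ \forall s\in S_i\}$. Then an element $m\in B\cap\mathbb{Z}^S$ is decreasingly minimal in $B\cap\mathbb{Z}^S$ if and only if the restriction $m|S_i$ belongs to $B_i\cap T_i$ for each $i=1,\dots,q$. Equivalently, the set of decreasingly minimal elements of $B\cap\mathbb{Z}^S$ is the set of integral points of the base-polyhedron obtained as the direct sum of the $B_i\cap T_i$.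
   Context: $\widetilde x(Z)=\sum_{s\in Z}x(s)$. Canonical partition: set $C_0=\emptyset$. Iteratively, for $j=1,2,\dots$, while $C_{j-1}\ne S$: let $p'_{j-1}(X)=p(X\cup C_{j-1})-p(C_{j-1})$ for $X\subseteq S-C_{j-1}$; let $\beta_j=\max\{\lceil p'_{j-1}(X)/|X|\rceil:\emptyset\ne X\subseteq S-C_{j-1}\}$; let $h_j(X)=p'_{j-1}(X)-(\beta_j-1)|X|$ for $X\subseteq S-C_{j-1}$; let $S_j$ be the smallest maximizer of $h_j$ (the intersection of all its maximizers), and $C_j=C_{j-1}\cup S_j$. When $C_j=S$ set $q=j$. (The $S_j$ are non-empty and $\beta_1>\beta_2>\cdots>\beta_q$.) An element $m$ of a set $Q$ of vectors is decreasingly minimal if, after sorting components in decreasing order, it is lexicographically smaller than or equal to every $y\in Q$ sorted likewise. -}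

module Defs where

open import Data.Nat as ℕ using (ℕ; zero; suc)
open import Data.Integer as ℤ using (ℤ; +_; _-_; -_; _/ℕ_; _<_; _≤_)
open import Data.Integer.Properties using (≤-decTotalOrder)
open import Data.Fin using (Fin)
open import Data.Fin.Subset using (Subset; _∈_; _⊆_; _∪_; _─_; ⊥; ⊤; ∣_∣; Nonempty)
open import Data.Vec using (lookup)
open import Data.Bool using (if_then_else_)
open import Data.List using (List; []; _∷_; reverse; map; foldr; allFin)
open import Data.List.Sort ≤-decTotalOrder using (sort)
open import Data.Product using (Σ; _×_; ∃)
open import Data.Sum using (_⊎_)
open import Data.Unit using () renaming (⊤ to Unit)
open import Data.Empty using () renaming (⊥ to Empty)
open import Relation.Binary.PropositionalEquality using (_≡_; _≢_)

data ℤ∞ : Set where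
  -∞  : ℤ∞
  fin : ℤ → ℤ∞

infixl 6 _+∞_ _⊖∞_
infix  4 _≤∞_

_+∞_ : ℤ∞ → ℤ∞ → ℤ∞
-∞    +∞ _     = -∞
fin a +∞ -∞    = -∞
fin a +∞ fin b = fin (a ℤ.+ b)

-- subtraction of a (finite) value; only ever used with a finite
-- right-hand side (p(C_{j-1}) is finite); convention: result -∞ otherwise
_⊖∞_ : ℤ∞ → ℤ∞ → ℤ∞
fin a ⊖∞ fin b = fin (a - b)
_     ⊖∞ _     = -∞

_≤∞_ : ℤ∞ → ℤ∞ → Set
-∞    ≤∞ _     = Unit
fin a ≤∞ -∞    = Empty
fin a ≤∞ fin b = a ≤ b

Supermodular : ∀ {n} → (Subset n → ℤ∞) → Set
Supermodular {n} p = ∀ (X Y : Subset n) →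
  p X +∞ p Y ≤∞ p (X Data.Fin.Subset.∩ Y) +∞ p (X ∪ Y)

tilde : ∀ {n} → (Fin n → ℤ) → Subset n → ℤ
tilde {n} x Z = foldr ℤ._+_ (+ 0) (map (λ s → if lookup Z s then x s else + 0) (allFin n))

InB : ∀ {n} → (Subset n → ℤ∞) → (Fin n → ℤ) → Set
InB {n} p x = (p ⊤ ≡ fin (tilde x ⊤)) × (∀ (Z : Subset n) → p Z ≤∞ fin (tilde x Z))

decSorted : ∀ {n} → (Fin n → ℤ) → List ℤ
decSorted {n} x = reverse (sort (map x (allFin n)))

LexLeq : List ℤ → List ℤ → Set
LexLeq []       []       = Unit
LexLeq []       (_ ∷ _)  = Unit
LexLeq (_ ∷ _)  []       = Empty
LexLeq (a ∷ as) (b ∷ bs) = (a < b) ⊎ ((a ≡ b) × LexLeq as bs)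

DecMin : ∀ {n} → ((Fin n → ℤ) → Set) → (Fin n → ℤ) → Set
DecMin Q m = Q m × (∀ y → Q y → LexLeq (decSorted m) (decSorted y))

-- ⌈ v / k ⌉ for k ≥ 1 (value at k = 0 is an irrelevant junk value)
ceilDiv : ℤ → ℕ → ℤ
ceilDiv v zero    = + 0
ceilDiv v (suc k) = - ((- v) /ℕ suc k)

ceilDiv∞ : ℤ∞ → ℕ → ℤ∞
ceilDiv∞ -∞      k = -∞
ceilDiv∞ (fin v) k = fin (ceilDiv v k)

shift : ∀ {n} → (Subset n → ℤ∞) → Subset n → Subset n → ℤ∞
shift p C X = p (X ∪ C) ⊖∞ p C

hfun : ∀ {n} → (Subset n → ℤ∞) → Subset n → ℤ → Subset n → ℤ∞
hfun p C β X = shift p C X ⊖∞ fin ((β - + 1) ℤ.* + ∣ X ∣)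

-- C_i = S_1 ∪ … ∪ S_i   (here the parts are indexed 0,…,q-1: Sp j = S_{j+1})
chain : ∀ {n} → (ℕ → Subset n) → ℕ → Subset n
chain Sp zero    = ⊥
chain Sp (suc i) = chain Sp i ∪ Sp i

-- the data (q, S_1..S_q, β_1..β_q) is the canonical partition of p,
-- exactly as defined by the iterative procedure (0-based indices:
-- Sp j = S_{j+1}, β j = β_{j+1}, chain Sp j = C_j).
record Canonical {n} (p : Subset n → ℤ∞) : Set where
  field
    q    : ℕ
    Sp   : ℕ → Subset n
    β    : ℕ → ℤ
    running : ∀ j → j ℕ.< q → chain Sp j ≢ ⊤
    stops   : chain Sp q ≡ ⊤
    -- β_{j+1} = max { ⌈p'_j(X)/|X|⌉ : ∅ ≠ X ⊆ S - C_j }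
    β-upper : ∀ j → j ℕ.< q → ∀ (X : Subset n) → Nonempty X → X ⊆ (⊤ ─ chain Sp j) →
              ceilDiv∞ (shift p (chain Sp j) X) ∣ X ∣ ≤∞ fin (β j)
    β-attained : ∀ j → j ℕ.< q → Σ (Subset n) λ X → Nonempty X × X ⊆ (⊤ ─ chain Sp j) ×
              (ceilDiv∞ (shift p (chain Sp j) X) ∣ X ∣ ≡ fin (β j))
    -- S_{j+1} is the smallest maximizer of h_{j+1} over subsets of S - C_j
    S-sub   : ∀ j → j ℕ.< q → Sp j ⊆ (⊤ ─ chain Sp j)
    S-max   : ∀ j → j ℕ.< q → ∀ (X : Subset n) → X ⊆ (⊤ ─ chain Sp j) →
              hfun p (chain Sp j) (β j) X ≤∞ hfun p (chain Sp j) (β j) (Sp j)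
    S-least : ∀ j → j ℕ.< q → ∀ (Y : Subset n) → Y ⊆ (⊤ ─ chain Sp j) →
              (∀ (X : Subset n) → X ⊆ (⊤ ─ chain Sp j) →
                 hfun p (chain Sp j) (β j) X ≤∞ hfun p (chain Sp j) (β j) Y) →
              Sp j ⊆ Y

InBi : ∀ {n} → (Subset n → ℤ∞) → (Sp : ℕ → Subset n) → ℕ → (Fin n → ℤ) → Set
InBi {n} p Sp j m =
  (shift p (chain Sp j) (Sp j) ≡ fin (tilde m (Sp j))) ×
  (∀ (Z : Subset n) → Z ⊆ Sp j → shift p (chain Sp j) Z ≤∞ fin (tilde m Z))

InTi : ∀ {n} → (Sp : ℕ → Subset n) → (β : ℕ → ℤ) → ℕ → (Fin n → ℤ) → Set
InTi Sp β j m = ∀ s → s ∈ Sp j → (β j - + 1 ≤ m s) × (m s ≤ β j)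

-- Call (s , t) an improving pair of an integral base vector y if y t + 2 ≤ y s and no y-tight set
-- contains s but not t. Moving one unit from s to t then stays in B, lowers the decreasingly sorted
-- vector lexicographically (one entry ≥ y s fewer, the same counts above y s) and lowers Σ y²; so a
-- decreasingly minimal vector has no improving pair, and by such moves every y ∈ B reaches a vector
-- that has none.
--
-- Without improving pairs, intersecting tight sets (a lattice, by supermodularity) gives each s a tight
-- neighbourhood on which y ≥ y s - 1. By induction on j, with C_j tight: y ≤ β_j outside C_j, and the
-- neighbourhoods of the elements of value ≥ β_j, minus C_j, form a maximiser W of h_j; hence S_j ⊆ W,
-- which gives m|S_j ∈ T_j, and maximality of S_j makes S_j ∪ C_j tight, which gives m|S_j ∈ B_j.
--
-- Conversely, the conditions fix the values on S_j within {β_j - 1, β_j} with sum p_j(S_j), so all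
-- vectors meeting them have, for every t, the same number of entries ≥ t, i.e. the same decreasing
-- sort; by the moves above it lies lexicographically below that of every y ∈ B.

module Submission where

open import Defs
open import Data.Nat using (ℕ; suc; _<_)
open import Data.Integer using (ℤ; +_)
open import Data.Fin using (Fin)
open import Data.Fin.Subset using (Subset; ⊥; ⊤)
open import Data.Product using (Σ; _×_)
open import Function.Bundles using (_⇔_)
open import Relation.Binary.PropositionalEquality using (_≡_)

open import Data.Bool using (Bool; true; false; if_then_else_; _∧_; _∨_)
open import Data.Empty using (⊥-elim)
open import Data.Fin as Fin using (zero; suc)
import Data.Fin.Properties as FinP
open import Data.Fin.Subset using (_∈_; _∉_; _⊆_; _∪_; _∩_; _─_; ∣_∣; ⁅_⁆; ⋃; ⋂)
import Data.Fin.Subset.Properties as SubsetP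
open import Data.Integer as ℤ using (_+_; _*_; _-_; -_; _≤_; _⊔_; -[1+_])
import Data.Integer.DivMod as ℤDivMod
import Data.Integer.Properties as ℤP
open import Data.Integer.Tactic.RingSolver using (solve-∀)
open import Data.List using (List; []; _∷_; map; foldr; allFin; tabulate; reverse)
import Data.List.Properties as ListP
open import Data.List.Relation.Binary.Permutation.Propositional using (_↭_)
import Data.List.Relation.Binary.Permutation.Propositional.Properties as PermP
open import Data.List.Relation.Unary.All as All using (All; []; _∷_)
import Data.List.Relation.Unary.All.Properties as AllP
open import Data.List.Relation.Unary.AllPairs as AllPairs using (AllPairs; []; _∷_)
import Data.List.Relation.Unary.AllPairs.Properties as AllPairsP
open import Data.List.Relation.Unary.Any as Any using (Any)
import Data.List.Relation.Unary.Any.Properties as AnyP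
import Data.List.Relation.Unary.Linked.Properties as LinkedP
open import Data.List.Sort ℤP.≤-decTotalOrder using (sort; sort-↗; sort-↭)
open import Data.Nat as ℕ using (zero)
open import Data.Nat.Induction using (<-wellFounded)
open import Data.Nat.ListAction using (sum)
open import Data.Nat.ListAction.Properties using (sum-↭)
import Data.Nat.Properties as ℕP
open import Data.Product using (_,_; proj₁; proj₂; Σ-syntax)
open import Data.Sum using (_⊎_; inj₁; inj₂)
open import Data.Unit using (tt)
open import Data.Vec using ([]; _∷_; lookup; here; there)
import Data.Vec.Properties as VecP
open import Function using (_∘_; id)
open import Function.Bundles using (mk⇔)
open import Induction.WellFounded using (Acc; acc)
open import Relation.Binary.Definitions using (tri<; tri≈; tri>)
open import Relation.Binary.PropositionalEquality using (_≢_; refl; sym; trans; cong; cong₂; subst; subst₂; module ≡-Reasoning)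
open import Relation.Nullary using (¬_; Dec; yes; no; does)
import Relation.Nullary.Decidable as Dec
open import Relation.Nullary.Decidable using (_×-dec_; ¬?)

≤-by-diff : ∀ {a b : ℤ} (d : ℤ) → b - a ≡ d → + 0 ≤ d → a ≤ b
≤-by-diff d b-a≡d 0≤d = ℤP.0≤i-j⇒j≤i (subst (+ 0 ≤_) (sym b-a≡d) 0≤d)

<⇒≤-1 : ∀ {a b : ℤ} → a ℤ.< b → a ≤ b - + 1
<⇒≤-1 {a} {b} a<b = subst (a ≤_) (ℤP.+-comm (- + 1) b) (ℤP.i<j⇒i≤pred[j] a<b)

≤-1⇒< : ∀ {a b : ℤ} → a ≤ b - + 1 → a ℤ.< b
≤-1⇒< {a} {b} a≤b-1 = ℤP.i≤pred[j]⇒i<j (subst (a ≤_) (ℤP.+-comm b (- + 1)) a≤b-1)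

i+j-j≡i : ∀ i j → i + j - j ≡ i
i+j-j≡i = solve-∀

i-j+j≡i : ∀ i j → i - j + j ≡ i
i-j+j≡i = solve-∀

+-squeezeˡ : ∀ {c d A B : ℤ} → c ≤ A → d ≤ B → A + B ≤ c + d → c ≡ A
+-squeezeˡ {c} {d} {A} {B} c≤A d≤B A+B≤c+d = ℤP.≤-antisym c≤A
  (≤-by-diff ((c + d) - (A + B) + (B - d)) (lemma c d A B)
    (ℤP.+-mono-≤ (ℤP.i≤j⇒0≤j-i A+B≤c+d) (ℤP.i≤j⇒0≤j-i d≤B)))
  where
  lemma : ∀ c d A B → c - A ≡ (c + d) - (A + B) + (B - d)
  lemma = solve-∀

ceilDiv-≤⇒≤* : ∀ v b k → ceilDiv v (suc k) ≤ b → v ≤ b * + suc k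
ceilDiv-≤⇒≤* v b k ceil≤b =
  ≤-by-diff ((- v) - (- b) * + suc k) (lemma v b (+ suc k))
    (ℤP.i≤j⇒0≤j-i (ℤP.≤-trans (ℤP.*-monoʳ-≤-nonNeg (+ suc k) -b≤q)
                               (ℤDivMod.[n/ℕd]*d≤n (- v) (suc k))))
  where
  lemma : ∀ v b d → b * d - v ≡ (- v) - (- b) * d
  lemma = solve-∀
  -b≤q : - b ≤ (- v) ℤ./ℕ suc k
  -b≤q = subst (- b ≤_) (ℤP.neg-involutive _) (ℤP.neg-mono-≤ ceil≤b)

ceilDiv-> : ∀ v c k → c * + k ℤ.< v → 0 < k → c ℤ.< ceilDiv v k
ceilDiv-> v c (suc k) c*k<v _ with ceilDiv v (suc k) ℤP.≤? c
... | yes ceil≤c = ⊥-elim (ℤP.<⇒≱ c*k<v (ceilDiv-≤⇒≤* v c k ceil≤c))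
... | no  ceil≰c = ℤP.≰⇒> ceil≰c

≤∞-trans : ∀ {u v w : ℤ∞} → u ≤∞ v → v ≤∞ w → u ≤∞ w
≤∞-trans { -∞} _ _ = tt
≤∞-trans {fin a} {fin b} {fin c} a≤b b≤c = ℤP.≤-trans a≤b b≤c

≤∞-antisym : ∀ {v : ℤ∞} {a : ℤ} → v ≤∞ fin a → fin a ≤∞ v → v ≡ fin a
≤∞-antisym {fin b} b≤a a≤b = cong fin (ℤP.≤-antisym b≤a a≤b)

≤∞-pred : ∀ {v : ℤ∞} {a : ℤ} → v ≤∞ fin a → v ≢ fin a → v ≤∞ fin (a - + 1)
≤∞-pred { -∞}   _   _   = tt
≤∞-pred {fin b} b≤a b≢a = <⇒≤-1 (ℤP.≤∧≢⇒< b≤a (b≢a ∘ cong fin))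

⊖∞-≤ : ∀ {v : ℤ∞} {a c : ℤ} → v ≤∞ fin a → v ⊖∞ fin c ≤∞ fin (a - c)
⊖∞-≤ { -∞}   _   = tt
⊖∞-≤ {fin b} b≤a = ℤP.+-monoˡ-≤ _ b≤a

⊖∞-≥ : ∀ {v : ℤ∞} {a c : ℤ} → fin (a - c) ≤∞ v ⊖∞ fin c → fin a ≤∞ v
⊖∞-≥ {fin b} {a} {c} a-c≤b-c = subst₂ _≤_ (i-j+j≡i a c) (i-j+j≡i b c) (ℤP.+-monoˡ-≤ c a-c≤b-c)

+∞-squeeze : ∀ {u v : ℤ∞} {A B : ℤ} → fin (A + B) ≤∞ u +∞ v → u ≤∞ fin A → v ≤∞ fin B →
             (u ≡ fin A) × (v ≡ fin B)
+∞-squeeze {fin c} {fin d} {A} {B} A+B≤c+d c≤A d≤B =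
  cong fin (+-squeezeˡ c≤A d≤B A+B≤c+d) ,
  cong fin (+-squeezeˡ d≤B c≤A (subst₂ _≤_ (ℤP.+-comm A B) (ℤP.+-comm c d) A+B≤c+d))

x∈p─q⁻ : ∀ {n} {x : Fin n} (p q : Subset n) → x ∈ p ─ q → x ∈ p × x ∉ q
x∈p─q⁻ (true ∷ p) (false ∷ q) here       = here , λ ()
x∈p─q⁻ (b ∷ p)    (true ∷ q)  (there x∈) =
  there (proj₁ (x∈p─q⁻ p q x∈)) , proj₂ (x∈p─q⁻ p q x∈) ∘ SubsetP.drop-there
x∈p─q⁻ (b ∷ p)    (false ∷ q) (there x∈) =
  there (proj₁ (x∈p─q⁻ p q x∈)) , proj₂ (x∈p─q⁻ p q x∈) ∘ SubsetP.drop-there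

─∪-cancel : ∀ {n} {p q : Subset n} → q ⊆ p → (p ─ q) ∪ q ≡ p
─∪-cancel {p = p} {q} q⊆p = SubsetP.⊆-antisym ⊆p p⊆
  where
  ⊆p : (p ─ q) ∪ q ⊆ p
  ⊆p x∈ with SubsetP.x∈p∪q⁻ (p ─ q) q x∈
  ... | inj₁ x∈p─q = proj₁ (x∈p─q⁻ p q x∈p─q)
  ... | inj₂ x∈q   = q⊆p x∈q
  p⊆ : p ⊆ (p ─ q) ∪ q
  p⊆ {x} x∈p with x SubsetP.∈? q
  ... | yes x∈q = SubsetP.q⊆p∪q (p ─ q) q x∈q
  ... | no  x∉q = SubsetP.p⊆p∪q q (SubsetP.x∈p∧x∉q⇒x∈p─q x∈p x∉q)

x∈p⇒⁅x⁆⊆p : ∀ {n} {s : Fin n} {Z : Subset n} → s ∈ Z → ⁅ s ⁆ ⊆ Z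
x∈p⇒⁅x⁆⊆p {s = s} {Z} s∈Z u∈ = subst (_∈ Z) (sym (SubsetP.x∈⁅y⁆⇒x≡y s u∈)) s∈Z

x∈⋂⁺ : ∀ {n} {x : Fin n} {Zs : List (Subset n)} → All (x ∈_) Zs → x ∈ ⋂ Zs
x∈⋂⁺ []         = SubsetP.∈⊤
x∈⋂⁺ (x∈Z ∷ x∈) = SubsetP.x∈p∩q⁺ (x∈Z , x∈⋂⁺ x∈)

x∈⋂⁻ : ∀ {n} {x : Fin n} (Zs : List (Subset n)) → x ∈ ⋂ Zs → All (x ∈_) Zs
x∈⋂⁻ []       x∈ = []
x∈⋂⁻ (Z ∷ Zs) x∈ = let (x∈Z , x∈⋂Zs) = SubsetP.x∈p∩q⁻ Z (⋂ Zs) x∈ in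
                    x∈Z ∷ x∈⋂⁻ Zs x∈⋂Zs

x∈⋃⁺ : ∀ {n} {x : Fin n} {Zs : List (Subset n)} → Any (x ∈_) Zs → x ∈ ⋃ Zs
x∈⋃⁺ {Zs = Z ∷ Zs} (Any.here x∈Z) = SubsetP.p⊆p∪q (⋃ Zs) x∈Z
x∈⋃⁺ {Zs = Z ∷ Zs} (Any.there x∈) = SubsetP.q⊆p∪q Z (⋃ Zs) (x∈⋃⁺ x∈)

x∈⋃⁻ : ∀ {n} {x : Fin n} (Zs : List (Subset n)) → x ∈ ⋃ Zs → Any (x ∈_) Zs
x∈⋃⁻ []       x∈ = ⊥-elim (SubsetP.∉⊥ x∈)
x∈⋃⁻ (Z ∷ Zs) x∈ with SubsetP.x∈p∪q⁻ Z (⋃ Zs) x∈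
... | inj₁ x∈Z    = Any.here x∈Z
... | inj₂ x∈⋃Zs = Any.there (x∈⋃⁻ Zs x∈⋃Zs)

lookup-⊤ : ∀ {n} (s : Fin n) → lookup ⊤ s ≡ true
lookup-⊤ s = VecP.lookup-replicate s true

when : Bool → ℤ → ℤ
when b v = if b then v else + 0

sumOn : ∀ {n} → (Fin n → ℤ) → Subset n → ℤ
sumOn x []          = + 0
sumOn x (true ∷ Z)  = x zero + sumOn (x ∘ suc) Z
sumOn x (false ∷ Z) = sumOn (x ∘ suc) Z

tilde≡sumOn : ∀ {n} (x : Fin n → ℤ) (Z : Subset n) → tilde x Z ≡ sumOn x Z
tilde≡sumOn x Z =
  trans (cong (foldr _+_ (+ 0)) (ListP.map-tabulate id (λ s → when (lookup Z s) (x s)))) (go x Z)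
  where
  go : ∀ {m} (x : Fin m → ℤ) (Z : Subset m) →
       foldr _+_ (+ 0) (tabulate (λ s → when (lookup Z s) (x s))) ≡ sumOn x Z
  go x []          = refl
  go x (true ∷ Z)  = cong (_+_ (x zero)) (go (x ∘ suc) Z)
  go x (false ∷ Z) = trans (ℤP.+-identityˡ _) (go (x ∘ suc) Z)

sumOn-cong : ∀ {n} {x y : Fin n → ℤ} (Z : Subset n) → (∀ i → i ∈ Z → x i ≡ y i) →
             sumOn x Z ≡ sumOn y Z
sumOn-cong []          h = refl
sumOn-cong (true ∷ Z)  h = cong₂ _+_ (h zero here) (sumOn-cong Z (λ i → h (suc i) ∘ there))
sumOn-cong (false ∷ Z) h = sumOn-cong Z (λ i → h (suc i) ∘ there)

sumOn-mono-≤ : ∀ {n} {x y : Fin n → ℤ} (Z : Subset n) → (∀ i → i ∈ Z → x i ≤ y i) →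
               sumOn x Z ≤ sumOn y Z
sumOn-mono-≤ []          h = ℤP.≤-refl
sumOn-mono-≤ (true ∷ Z)  h = ℤP.+-mono-≤ (h zero here) (sumOn-mono-≤ Z (λ i → h (suc i) ∘ there))
sumOn-mono-≤ (false ∷ Z) h = sumOn-mono-≤ Z (λ i → h (suc i) ∘ there)

sumOn-nonNeg : ∀ {n} {x : Fin n → ℤ} (Z : Subset n) → (∀ i → i ∈ Z → + 0 ≤ x i) →
               + 0 ≤ sumOn x Z
sumOn-nonNeg []          h = ℤP.≤-refl
sumOn-nonNeg (true ∷ Z)  h = ℤP.+-mono-≤ (h zero here) (sumOn-nonNeg Z (λ i → h (suc i) ∘ there))
sumOn-nonNeg (false ∷ Z) h = sumOn-nonNeg Z (λ i → h (suc i) ∘ there)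

sumOn-+ : ∀ {n} (x y : Fin n → ℤ) (Z : Subset n) →
          sumOn (λ i → x i + y i) Z ≡ sumOn x Z + sumOn y Z
sumOn-+ x y []          = refl
sumOn-+ x y (true ∷ Z)  = trans (cong (_+_ (x zero + y zero)) (sumOn-+ (x ∘ suc) (y ∘ suc) Z))
                                (interchange (x zero) (y zero) (sumOn (x ∘ suc) Z) (sumOn (y ∘ suc) Z))
  where
  interchange : ∀ a b c d → (a + b) + (c + d) ≡ (a + c) + (b + d)
  interchange = solve-∀
sumOn-+ x y (false ∷ Z) = sumOn-+ (x ∘ suc) (y ∘ suc) Z

sumOn-const : ∀ {n} (c : ℤ) (Z : Subset n) → sumOn (λ _ → c) Z ≡ c * + ∣ Z ∣
sumOn-const c []          = sym (ℤP.*-zeroʳ c)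
sumOn-const c (true ∷ Z)  = trans (cong (_+_ c) (sumOn-const c Z)) (lemma c (+ ∣ Z ∣))
  where
  lemma : ∀ c k → c + c * k ≡ c * (+ 1 + k)
  lemma = solve-∀
sumOn-const c (false ∷ Z) = sumOn-const c Z

sumOn-shift : ∀ {n} (x : Fin n → ℤ) (c : ℤ) (Z : Subset n) →
              sumOn (λ i → x i - c) Z ≡ sumOn x Z - c * + ∣ Z ∣
sumOn-shift x c Z = begin
  sumOn (λ i → x i - c) Z          ≡⟨ sumOn-+ x (λ _ → - c) Z ⟩
  sumOn x Z + sumOn (λ _ → - c) Z  ≡⟨ cong (_+_ (sumOn x Z)) (sumOn-const (- c) Z) ⟩
  sumOn x Z + (- c) * + ∣ Z ∣      ≡⟨ cong (_+_ (sumOn x Z)) (sym (ℤP.neg-distribˡ-* c (+ ∣ Z ∣))) ⟩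
  sumOn x Z - c * + ∣ Z ∣          ∎
  where open ≡-Reasoning

sumOn-⊥ : ∀ {n} (x : Fin n → ℤ) → sumOn x ⊥ ≡ + 0
sumOn-⊥ {zero}  x = refl
sumOn-⊥ {suc n} x = sumOn-⊥ (x ∘ suc)

sumOn-∷ : ∀ {n} b (x : Fin (suc n) → ℤ) (Z : Subset n) →
          sumOn x (b ∷ Z) ≡ when b (x zero) + sumOn (x ∘ suc) Z
sumOn-∷ true  x Z = refl
sumOn-∷ false x Z = sym (ℤP.+-identityˡ _)

sumOn-∪+∩ : ∀ {n} (x : Fin n → ℤ) (X Y : Subset n) →
            sumOn x (X ∪ Y) + sumOn x (X ∩ Y) ≡ sumOn x X + sumOn x Y
sumOn-∪+∩ x []      []      = refl
sumOn-∪+∩ x (b ∷ X) (c ∷ Y) = begin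
  sumOn x ((b ∨ c) ∷ X ∪ Y) + sumOn x ((b ∧ c) ∷ X ∩ Y)
    ≡⟨ cong₂ _+_ (sumOn-∷ (b ∨ c) x (X ∪ Y)) (sumOn-∷ (b ∧ c) x (X ∩ Y)) ⟩
  (when (b ∨ c) v + sumOn x' (X ∪ Y)) + (when (b ∧ c) v + sumOn x' (X ∩ Y))
    ≡⟨ interchange (when (b ∨ c) v) (sumOn x' (X ∪ Y)) (when (b ∧ c) v) (sumOn x' (X ∩ Y)) ⟩
  (when (b ∨ c) v + when (b ∧ c) v) + (sumOn x' (X ∪ Y) + sumOn x' (X ∩ Y))
    ≡⟨ cong₂ _+_ (∨+∧ b c) (sumOn-∪+∩ x' X Y) ⟩
  (when b v + when c v) + (sumOn x' X + sumOn x' Y)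
    ≡⟨ interchange (when b v) (when c v) (sumOn x' X) (sumOn x' Y) ⟩
  (when b v + sumOn x' X) + (when c v + sumOn x' Y)
    ≡⟨ sym (cong₂ _+_ (sumOn-∷ b x X) (sumOn-∷ c x Y)) ⟩
  sumOn x (b ∷ X) + sumOn x (c ∷ Y)  ∎
  where
  open ≡-Reasoning
  v : ℤ
  v = x zero
  x' : Fin _ → ℤ
  x' = x ∘ suc
  interchange : ∀ a b c d → (a + b) + (c + d) ≡ (a + c) + (b + d)
  interchange = solve-∀
  ∨+∧ : ∀ b c → when (b ∨ c) v + when (b ∧ c) v ≡ when b v + when c v
  ∨+∧ true  true  = refl
  ∨+∧ true  false = refl
  ∨+∧ false true  = ℤP.+-comm v (+ 0)
  ∨+∧ false false = refl

sumOn-∪-disjoint : ∀ {n} (x : Fin n → ℤ) (X Y : Subset n) → (∀ {i} → i ∈ X → i ∉ Y) →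
                   sumOn x (X ∪ Y) ≡ sumOn x X + sumOn x Y
sumOn-∪-disjoint x X Y disjoint = begin
  sumOn x (X ∪ Y)                    ≡⟨ sym (ℤP.+-identityʳ _) ⟩
  sumOn x (X ∪ Y) + + 0              ≡⟨ cong (_+_ (sumOn x (X ∪ Y))) (sym (sumOn-⊥ x)) ⟩
  sumOn x (X ∪ Y) + sumOn x ⊥        ≡⟨ cong (λ Z → sumOn x (X ∪ Y) + sumOn x Z) (sym X∩Y≡⊥) ⟩
  sumOn x (X ∪ Y) + sumOn x (X ∩ Y)  ≡⟨ sumOn-∪+∩ x X Y ⟩
  sumOn x X + sumOn x Y              ∎
  where
  open ≡-Reasoning
  X∩Y≡⊥ : X ∩ Y ≡ ⊥
  X∩Y≡⊥ = SubsetP.Empty-unique λ (i , i∈) →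
            let (i∈X , i∈Y) = SubsetP.x∈p∩q⁻ X Y i∈ in disjoint i∈X i∈Y

sumOn-split : ∀ {n} (x : Fin n → ℤ) {X Y : Subset n} → X ⊆ Y →
              sumOn x Y ≡ sumOn x (Y ─ X) + sumOn x X
sumOn-split x {X} {Y} X⊆Y = trans (cong (sumOn x) (sym (─∪-cancel X⊆Y)))
                                  (sumOn-∪-disjoint x (Y ─ X) X (proj₂ ∘ x∈p─q⁻ Y X))

sumOn-mono-⊆ : ∀ {n} {x : Fin n → ℤ} {X Y : Subset n} → (∀ i → i ∈ Y → + 0 ≤ x i) → X ⊆ Y →
               sumOn x X ≤ sumOn x Y
sumOn-mono-⊆ {x = x} {X} {Y} nonNeg X⊆Y =
  subst₂ _≤_ (ℤP.+-identityˡ (sumOn x X)) (sym (sumOn-split x X⊆Y))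
    (ℤP.+-monoˡ-≤ (sumOn x X) (sumOn-nonNeg (Y ─ X) (λ i i∈ → nonNeg i (proj₁ (x∈p─q⁻ Y X i∈)))))

sumOn-vanishing : ∀ {n} {x : Fin n → ℤ} {X Y : Subset n} → X ⊆ Y → (∀ i → i ∈ Y → i ∉ X → x i ≡ + 0) →
                  sumOn x X ≡ sumOn x Y
sumOn-vanishing {x = x} {X} {Y} X⊆Y vanish = sym (begin
  sumOn x Y                            ≡⟨ sumOn-split x X⊆Y ⟩
  sumOn x (Y ─ X) + sumOn x X          ≡⟨ cong (_+ sumOn x X) (sumOn-cong (Y ─ X) zero-outside) ⟩
  sumOn (λ _ → + 0) (Y ─ X) + sumOn x X ≡⟨ cong (_+ sumOn x X) (sumOn-const (+ 0) (Y ─ X)) ⟩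
  + 0 + sumOn x X                      ≡⟨ ℤP.+-identityˡ _ ⟩
  sumOn x X                            ∎)
  where
  open ≡-Reasoning
  zero-outside : ∀ i → i ∈ Y ─ X → x i ≡ + 0
  zero-outside i i∈ = let (i∈Y , i∉X) = x∈p─q⁻ Y X i∈ in vanish i i∈Y i∉X

sumOn-⁅⁆ : ∀ {n} (x : Fin n → ℤ) (s : Fin n) → sumOn x ⁅ s ⁆ ≡ x s
sumOn-⁅⁆ x zero    = trans (cong (_+_ (x zero)) (sumOn-⊥ (x ∘ suc))) (ℤP.+-identityʳ (x zero))
sumOn-⁅⁆ x (suc s) = sumOn-⁅⁆ (x ∘ suc) s

elem≤sumOn : ∀ {n} {x : Fin n → ℤ} {Z : Subset n} {s : Fin n} → (∀ i → i ∈ Z → + 0 ≤ x i) → s ∈ Z →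
             x s ≤ sumOn x Z
elem≤sumOn {x = x} {s = s} nonNeg s∈Z =
  subst (_≤ _) (sumOn-⁅⁆ x s) (sumOn-mono-⊆ nonNeg (x∈p⇒⁅x⁆⊆p s∈Z))

≤-ceilDiv-mean : ∀ {n} (x : Fin n → ℤ) {X : Subset n} {s : Fin n} →
                 s ∈ X → (∀ u → u ∈ X → x s - + 1 ≤ x u) → x s ≤ ceilDiv (sumOn x X) ∣ X ∣
≤-ceilDiv-mean x {X} {s} s∈X near =
  subst (_≤ _) (lemma (x s)) (ℤP.i<j⇒suc[i]≤j (ceilDiv-> (sumOn x X) c ∣ X ∣ c*∣X∣<sum 0<∣X∣))
  where
  c : ℤ
  c = x s - + 1
  lemma : ∀ a → + 1 + (a - + 1) ≡ a
  lemma = solve-∀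
  lemma₂ : ∀ a → a - (a - + 1) ≡ + 1
  lemma₂ = solve-∀
  lemma₃ : ∀ S K → S - (+ 1 + K) ≡ (S - K) - + 1
  lemma₃ = solve-∀
  1≤excess : + 1 ≤ sumOn x X - c * + ∣ X ∣
  1≤excess = subst₂ _≤_ (lemma₂ (x s)) (sumOn-shift x c X)
               (elem≤sumOn (λ u u∈ → ℤP.i≤j⇒0≤j-i (near u u∈)) s∈X)
  c*∣X∣<sum : c * + ∣ X ∣ ℤ.< sumOn x X
  c*∣X∣<sum = ℤP.suc[i]≤j⇒i<j
    (≤-by-diff _ (lemma₃ (sumOn x X) (c * + ∣ X ∣)) (ℤP.i≤j⇒0≤j-i 1≤excess))
  0<∣X∣ : 0 < ∣ X ∣
  0<∣X∣ = subst (ℕ._≤ ∣ X ∣) (SubsetP.∣⁅x⁆∣≡1 s) (SubsetP.p⊆q⇒∣p∣≤∣q∣ (x∈p⇒⁅x⁆⊆p s∈X))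

addAt : ∀ {n} → Fin n → ℤ → (Fin n → ℤ) → Fin n → ℤ
addAt s c x i = if does (i Fin.≟ s) then x i + c else x i

addAt-≡ : ∀ {n} (s : Fin n) c (x : Fin n → ℤ) → addAt s c x s ≡ x s + c
addAt-≡ s c x with s Fin.≟ s
... | yes _   = refl
... | no  s≢s = ⊥-elim (s≢s refl)

addAt-≢ : ∀ {n} {s i : Fin n} c (x : Fin n → ℤ) → i ≢ s → addAt s c x i ≡ x i
addAt-≢ {s = s} {i} c x i≢s with i Fin.≟ s
... | yes i≡s = ⊥-elim (i≢s i≡s)
... | no  _   = refl

sumOn-addAt : ∀ {n} (s : Fin n) c (x : Fin n → ℤ) (Z : Subset n) →
              sumOn (addAt s c x) Z ≡ sumOn x Z + when (lookup Z s) c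
sumOn-addAt zero    c x (b ∷ Z) = begin
  sumOn (addAt zero c x) (b ∷ Z)                    ≡⟨ sumOn-∷ b (addAt zero c x) Z ⟩
  when b (x zero + c) + sumOn (x ∘ suc) Z           ≡⟨ cong (_+ sumOn (x ∘ suc) Z) (when-+ b) ⟩
  (when b (x zero) + when b c) + sumOn (x ∘ suc) Z  ≡⟨ swap (when b (x zero)) (when b c) _ ⟩
  (when b (x zero) + sumOn (x ∘ suc) Z) + when b c  ≡⟨ cong (_+ when b c) (sym (sumOn-∷ b x Z)) ⟩
  sumOn x (b ∷ Z) + when b c                        ∎
  where
  open ≡-Reasoning
  when-+ : ∀ b → when b (x zero + c) ≡ when b (x zero) + when b c
  when-+ true  = refl
  when-+ false = refl
  swap : ∀ a b r → (a + b) + r ≡ (a + r) + b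
  swap = solve-∀
sumOn-addAt (suc s) c x (b ∷ Z) = begin
  sumOn (addAt (suc s) c x) (b ∷ Z)
    ≡⟨ sumOn-∷ b (addAt (suc s) c x) Z ⟩
  when b (x zero) + sumOn (addAt s c (x ∘ suc)) Z
    ≡⟨ cong (_+_ (when b (x zero))) (sumOn-addAt s c (x ∘ suc) Z) ⟩
  when b (x zero) + (sumOn (x ∘ suc) Z + when (lookup Z s) c)
    ≡⟨ sym (ℤP.+-assoc (when b (x zero)) _ _) ⟩
  (when b (x zero) + sumOn (x ∘ suc) Z) + when (lookup Z s) c
    ≡⟨ cong (_+ when (lookup Z s) c) (sym (sumOn-∷ b x Z)) ⟩
  sumOn x (b ∷ Z) + when (lookup Z s) c  ∎
  where open ≡-Reasoning

0≤i*i : ∀ i → + 0 ≤ i * i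
0≤i*i (+ n)    = subst (+ 0 ≤_) (ℤP.pos-* n n) (ℤ.+≤+ ℕ.z≤n)
0≤i*i -[1+ n ] = ℤ.+≤+ ℕ.z≤n

sumOfSquares : ∀ {n} → (Fin n → ℤ) → ℤ
sumOfSquares x = sumOn (λ i → x i * x i) ⊤

+∣sumOfSquares∣ : ∀ {n} (x : Fin n → ℤ) → + ℤ.∣ sumOfSquares x ∣ ≡ sumOfSquares x
+∣sumOfSquares∣ x = ℤP.0≤i⇒+∣i∣≡i (sumOn-nonNeg ⊤ (λ i _ → 0≤i*i (x i)))

sumOfSquares-addAt : ∀ {n} (s : Fin n) c (x : Fin n → ℤ) →
                     sumOfSquares (addAt s c x) ≡ sumOfSquares x + (+ 2 * c * x s + c * c)
sumOfSquares-addAt s c x = begin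
  sumOn (λ i → addAt s c x i * addAt s c x i) ⊤  ≡⟨ sumOn-cong ⊤ (λ i _ → square-addAt i) ⟩
  sumOn (addAt s K square) ⊤                      ≡⟨ sumOn-addAt s K square ⊤ ⟩
  sumOfSquares x + when (lookup ⊤ s) K            ≡⟨ cong (λ b → sumOfSquares x + when b K) (lookup-⊤ s) ⟩
  sumOfSquares x + K                              ∎
  where
  open ≡-Reasoning
  square : Fin _ → ℤ
  square i = x i * x i
  K : ℤ
  K = + 2 * c * x s + c * c
  expand : ∀ a c → (a + c) * (a + c) ≡ a * a + (+ 2 * c * a + c * c)
  expand = solve-∀
  square-addAt : ∀ i → addAt s c x i * addAt s c x i ≡ addAt s K square i
  square-addAt i with i Fin.≟ s
  ... | yes refl = expand (x s) c
  ... | no  _    = refl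

-- Counting entries above a threshold

𝟙≥ : ℤ → ℤ → ℕ
𝟙≥ t v = if does (t ℤP.≤? v) then 1 else 0

𝟙≥-yes : ∀ {t v} → t ≤ v → 𝟙≥ t v ≡ 1
𝟙≥-yes {t} {v} t≤v with t ℤP.≤? v
... | yes _   = refl
... | no  t≰v = ⊥-elim (t≰v t≤v)

𝟙≥-no : ∀ {t v} → v ℤ.< t → 𝟙≥ t v ≡ 0
𝟙≥-no {t} {v} v<t with t ℤP.≤? v
... | yes t≤v = ⊥-elim (ℤP.<⇒≱ v<t t≤v)
... | no  _   = refl

count≥ : ℤ → List ℤ → ℕ
count≥ t xs = sum (map (𝟙≥ t) xs)

count≥-↭ : ∀ t {xs ys : List ℤ} → xs ↭ ys → count≥ t xs ≡ count≥ t ys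
count≥-↭ t xs↭ys = sum-↭ (PermP.map⁺ (𝟙≥ t) xs↭ys)

Descending : List ℤ → Set
Descending = AllPairs (λ a b → b ≤ a)

count≥-below : ∀ {x u} (xs : List ℤ) → All (_≤ x) xs → x ℤ.< u → count≥ u xs ≡ 0
count≥-below []       []         x<u = refl
count≥-below (v ∷ xs) (v≤x ∷ ≤x) x<u = cong₂ ℕ._+_ (𝟙≥-no (ℤP.≤-<-trans v≤x x<u)) (count≥-below xs ≤x x<u)

count≥-above-head : ∀ {x u} (xs : List ℤ) → Descending (x ∷ xs) → x ℤ.< u → count≥ u (x ∷ xs) ≡ 0
count≥-above-head {x} xs (≤x ∷ _) x<u = count≥-below (x ∷ xs) (ℤP.≤-refl ∷ ≤x) x<u

count≥-head : ∀ x (xs : List ℤ) → 1 ℕ.≤ count≥ x (x ∷ xs)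
count≥-head x xs rewrite 𝟙≥-yes (ℤP.≤-refl {x}) = ℕ.s≤s ℕ.z≤n

CountDominated : List ℤ → List ℤ → Set
CountDominated a b = ∀ t → (∀ u → t ℤ.< u → count≥ u a ≡ count≥ u b) →
                     count≥ t a ℕ.≤ count≥ t b

lex-from-counts : ∀ (a b : List ℤ) → Descending a → Descending b → CountDominated a b → LexLeq a b
lex-from-counts []       []       _    _    _   = tt
lex-from-counts []       (y ∷ bs) _    _    _   = tt
lex-from-counts (x ∷ as) []       da   _    dom =
  ℕP.<-irrefl refl (ℕP.≤-trans (count≥-head x as) (dom x (λ u x<u → count≥-above-head as da x<u)))
lex-from-counts (x ∷ as) (y ∷ bs) da   db   dom with ℤP.<-cmp x y
... | tri< x<y _ _    = inj₁ x<y
... | tri≈ _ refl _   = inj₂ (refl , lex-from-counts as bs (AllPairs.tail da) (AllPairs.tail db) dom-tail)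
  where
  dom-tail : CountDominated as bs
  dom-tail t agree = ℕP.+-cancelˡ-≤ (𝟙≥ t x) _ _ (dom t (λ u t<u → cong (𝟙≥ u x ℕ.+_) (agree u t<u)))
... | tri> _ _ y<x    = ⊥-elim (ℕP.<-irrefl refl (ℕP.≤-trans (count≥-head x as)
                                                 (ℕP.≤-trans (dom x none-above) (ℕP.≤-reflexive none-at-x))))
  where
  none-at-x : count≥ x (y ∷ bs) ≡ 0
  none-at-x = count≥-above-head bs db y<x
  none-above : ∀ u → x ℤ.< u → count≥ u (x ∷ as) ≡ count≥ u (y ∷ bs)
  none-above u x<u = trans (count≥-above-head as da x<u) (sym (count≥-above-head bs db (ℤP.<-trans y<x x<u)))

counts-from-lex : ∀ (a b : List ℤ) → Descending a → Descending b → LexLeq a b → CountDominated a b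
counts-from-lex []       _        _  _  _ t _ = ℕ.z≤n
counts-from-lex (x ∷ as) (y ∷ bs) da db (inj₁ x<y) t agree with t ℤP.≤? x
... | yes t≤x = ⊥-elim (ℕP.<-irrefl refl (ℕP.≤-trans (count≥-head y bs) (ℕP.≤-reflexive
                  (trans (sym (agree y (ℤP.≤-<-trans t≤x x<y))) (count≥-above-head as da x<y)))))
... | no  t≰x = ℕP.≤-trans (ℕP.≤-reflexive (count≥-below as (AllPairs.head da) (ℤP.≰⇒> t≰x))) ℕ.z≤n
counts-from-lex (x ∷ as) (.x ∷ bs) da db (inj₂ (refl , as≤bs)) t agree =
  ℕP.+-monoʳ-≤ (𝟙≥ t x) (counts-from-lex as bs (AllPairs.tail da) (AllPairs.tail db) as≤bs t
    (λ u t<u → ℕP.+-cancelˡ-≡ (𝟙≥ u x) _ _ (agree u t<u)))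

lex<-from-count-drop : ∀ {a b : List ℤ} → Descending a → Descending b → ∀ t₀ →
                       (∀ u → t₀ ℤ.< u → count≥ u a ≡ count≥ u b) → count≥ t₀ a ℕ.< count≥ t₀ b →
                       LexLeq a b × ¬ LexLeq b a
lex<-from-count-drop {a} {b} da db t₀ agree drop = lex-from-counts a b da db dominated , not-above
  where
  dominated : CountDominated a b
  dominated t agree-above-t with ℤP.<-cmp t₀ t
  ... | tri< t₀<t _ _  = ℕP.≤-reflexive (agree t t₀<t)
  ... | tri≈ _ refl _  = ℕP.<⇒≤ drop
  ... | tri> _ _ t<t₀  = ⊥-elim (ℕP.<⇒≢ drop (agree-above-t t₀ t<t₀))
  not-above : ¬ LexLeq b a
  not-above b≤a = ℕP.<⇒≱ drop (counts-from-lex b a db da b≤a t₀ (λ u t₀<u → sym (agree u t₀<u)))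

LexLeq-trans : ∀ (a b c : List ℤ) → LexLeq a b → LexLeq b c → LexLeq a c
LexLeq-trans []      []       c        _                   b≤c                 = b≤c
LexLeq-trans []      (_ ∷ _)  (_ ∷ _)  _                   _                   = tt
LexLeq-trans (x ∷ a) (y ∷ b)  (z ∷ c)  (inj₁ x<y)          (inj₁ y<z)          = inj₁ (ℤP.<-trans x<y y<z)
LexLeq-trans (x ∷ a) (y ∷ b)  (.y ∷ c) (inj₁ x<y)          (inj₂ (refl , _))   = inj₁ x<y
LexLeq-trans (x ∷ a) (.x ∷ b) (z ∷ c)  (inj₂ (refl , _))   (inj₁ x<z)          = inj₁ x<z
LexLeq-trans (x ∷ a) (.x ∷ b) (.x ∷ c) (inj₂ (refl , a≤b)) (inj₂ (refl , b≤c)) =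
  inj₂ (refl , LexLeq-trans a b c a≤b b≤c)

All-reverse : ∀ {P : ℤ → Set} {xs : List ℤ} → All P xs → All P (reverse xs)
All-reverse Pxs = All.tabulate (λ x∈ → All.lookup Pxs (AnyP.reverse⁻ x∈))

reverse-descending : ∀ {xs : List ℤ} → AllPairs _≤_ xs → Descending (reverse xs)
reverse-descending {[]}     []         = []
reverse-descending {x ∷ xs} (x≤ ∷ ≤xs) = subst Descending (sym (ListP.unfold-reverse x xs))
  (AllPairsP.++⁺ (reverse-descending ≤xs) ([] ∷ []) (All.map (_∷ []) (All-reverse x≤)))

decSorted-descending : ∀ {n} (x : Fin n → ℤ) → Descending (decSorted x)
decSorted-descending {n} x =
  reverse-descending (LinkedP.Linked⇒AllPairs ℤP.≤-trans (sort-↗ (map x (allFin n))))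

countAbove : ∀ {n} → (Fin n → ℤ) → ℤ → Subset n → ℤ
countAbove x t Z = sumOn (λ i → + 𝟙≥ t (x i)) Z

+sum-tabulate : ∀ {n} (f : Fin n → ℕ) → + sum (tabulate f) ≡ sumOn (+_ ∘ f) ⊤
+sum-tabulate {zero}  f = refl
+sum-tabulate {suc n} f =
  trans (ℤP.pos-+ (f zero) _) (cong (_+_ (+ f zero)) (+sum-tabulate (f ∘ suc)))

count≥-decSorted : ∀ {n} (x : Fin n → ℤ) t → + count≥ t (decSorted x) ≡ countAbove x t ⊤
count≥-decSorted {n} x t = begin
  + count≥ t (decSorted x)                  ≡⟨ cong +_ (count≥-↭ t (PermP.↭-reverse (sort xs))) ⟩
  + count≥ t (sort xs)                      ≡⟨ cong +_ (count≥-↭ t (sort-↭ xs)) ⟩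
  + sum (map (𝟙≥ t) (map x (tabulate id)))  ≡⟨ cong (λ ys → + count≥ t ys) (ListP.map-tabulate id x) ⟩
  + sum (map (𝟙≥ t) (tabulate x))           ≡⟨ cong (+_ ∘ sum) (ListP.map-tabulate x (𝟙≥ t)) ⟩
  + sum (tabulate (𝟙≥ t ∘ x))               ≡⟨ +sum-tabulate (𝟙≥ t ∘ x) ⟩
  countAbove x t ⊤                          ∎
  where
  open ≡-Reasoning
  xs : List ℤ
  xs = map x (allFin n)

InBand : ∀ {n} → ℤ → Subset n → (Fin n → ℤ) → Set
InBand b Z x = ∀ s → s ∈ Z → (b - + 1 ≤ x s) × (x s ≤ b)

𝟙≥-top : ∀ {b v} → b - + 1 ≤ v → v ≤ b → + 𝟙≥ b v ≡ v - (b - + 1)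
𝟙≥-top {b} {v} b-1≤v v≤b with b ℤP.≤? v
... | yes b≤v = subst (λ w → + 1 ≡ w - (b - + 1)) (ℤP.≤-antisym b≤v v≤b) (lemma b)
  where
  lemma : ∀ b → + 1 ≡ b - (b - + 1)
  lemma = solve-∀
... | no  b≰v = subst (λ w → + 0 ≡ w - (b - + 1)) (ℤP.≤-antisym b-1≤v (<⇒≤-1 (ℤP.≰⇒> b≰v)))
                      (sym (ℤP.+-inverseʳ (b - + 1)))

countAbove-band : ∀ {n} {b : ℤ} {Z : Subset n} {x y : Fin n → ℤ} → InBand b Z x → InBand b Z y →
                  sumOn x Z ≡ sumOn y Z → ∀ t → countAbove x t Z ≡ countAbove y t Z
countAbove-band {b = b} {Z} {x} {y} x∈ y∈ sums t with ℤP.<-cmp t b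
... | tri< t<b _ _ = sumOn-cong Z λ i i∈ → cong +_ (trans (𝟙≥-yes (ℤP.≤-trans (<⇒≤-1 t<b) (proj₁ (x∈ i i∈))))
                                                      (sym (𝟙≥-yes (ℤP.≤-trans (<⇒≤-1 t<b) (proj₁ (y∈ i i∈))))))
... | tri> _ _ b<t = sumOn-cong Z λ i i∈ → cong +_ (trans (𝟙≥-no (ℤP.≤-<-trans (proj₂ (x∈ i i∈)) b<t))
                                                      (sym (𝟙≥-no (ℤP.≤-<-trans (proj₂ (y∈ i i∈)) b<t))))
... | tri≈ _ refl _ = begin
  countAbove x b Z               ≡⟨ sumOn-cong Z (λ i i∈ → 𝟙≥-top (proj₁ (x∈ i i∈)) (proj₂ (x∈ i i∈))) ⟩
  sumOn (λ i → x i - (b - + 1)) Z ≡⟨ sumOn-shift x (b - + 1) Z ⟩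
  sumOn x Z - (b - + 1) * + ∣ Z ∣ ≡⟨ cong (_- (b - + 1) * + ∣ Z ∣) sums ⟩
  sumOn y Z - (b - + 1) * + ∣ Z ∣ ≡⟨ sym (sumOn-shift y (b - + 1) Z) ⟩
  sumOn (λ i → y i - (b - + 1)) Z ≡⟨ sym (sumOn-cong Z (λ i i∈ → 𝟙≥-top (proj₁ (y∈ i i∈)) (proj₂ (y∈ i i∈)))) ⟩
  countAbove y b Z               ∎
  where open ≡-Reasoning

-- Moving one unit from s to t

transfer : ∀ {n} → Fin n → Fin n → (Fin n → ℤ) → Fin n → ℤ
transfer s t y = addAt t (+ 1) (addAt s (- + 1) y)

sumOn-transfer : ∀ {n} (s t : Fin n) (y : Fin n → ℤ) (Z : Subset n) →
                 sumOn (transfer s t y) Z ≡ sumOn y Z + when (lookup Z s) (- + 1) + when (lookup Z t) (+ 1)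
sumOn-transfer s t y Z = trans (sumOn-addAt t (+ 1) (addAt s (- + 1) y) Z)
                               (cong (_+ when (lookup Z t) (+ 1)) (sumOn-addAt s (- + 1) y Z))

module Transfer {n} (y : Fin n → ℤ) {s t : Fin n} (gap : y t + + 2 ≤ y s) where

  y' : Fin n → ℤ
  y' = transfer s t y

  yt+1<ys : y t + + 1 ℤ.< y s
  yt+1<ys = ℤP.suc[i]≤j⇒i<j (subst (_≤ y s) (lemma (y t)) gap)
    where
    lemma : ∀ a → a + + 2 ≡ + 1 + (a + + 1)
    lemma = solve-∀

  yt<ys : y t ℤ.< y s
  yt<ys = ℤP.<-trans (ℤP.suc[i]≤j⇒i<j (ℤP.≤-reflexive (ℤP.+-comm (+ 1) (y t)))) yt+1<ys

  s≢t : s ≢ t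
  s≢t refl = ℤP.<-irrefl refl yt<ys

  transfer-at-s : y' s ≡ y s - + 1
  transfer-at-s = trans (addAt-≢ (+ 1) (addAt s (- + 1) y) s≢t) (addAt-≡ s (- + 1) y)

  transfer-at-t : y' t ≡ y t + + 1
  transfer-at-t = trans (addAt-≡ t (+ 1) (addAt s (- + 1) y)) (cong (_+ + 1) (addAt-≢ (- + 1) y (s≢t ∘ sym)))

  transfer-elsewhere : ∀ {i} → i ≢ s → i ≢ t → y' i ≡ y i
  transfer-elsewhere i≢s i≢t = trans (addAt-≢ (+ 1) (addAt s (- + 1) y) i≢t) (addAt-≢ (- + 1) y i≢s)

  𝟙≥-transfer : ∀ u → y s ≤ u → ∀ i → + 𝟙≥ u (y i) ≡ addAt s (+ 𝟙≥ u (y s)) (λ j → + 𝟙≥ u (y' j)) i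
  𝟙≥-transfer u ys≤u i = by-cases (i Fin.≟ s) (i Fin.≟ t)
    where
    c : ℤ
    c = + 𝟙≥ u (y s)
    f : Fin n → ℤ
    f j = + 𝟙≥ u (y' j)
    by-cases : Dec (i ≡ s) → Dec (i ≡ t) → + 𝟙≥ u (y i) ≡ addAt s c f i
    by-cases (yes refl) _ = sym (begin
      addAt s c f s           ≡⟨ addAt-≡ s c f ⟩
      + 𝟙≥ u (y' s) + c       ≡⟨ cong (λ v → + 𝟙≥ u v + c) transfer-at-s ⟩
      + 𝟙≥ u (y s - + 1) + c  ≡⟨ cong (λ k → + k + c) (𝟙≥-no (ℤP.<-≤-trans (≤-1⇒< ℤP.≤-refl) ys≤u)) ⟩
      + 0 + c                 ≡⟨ ℤP.+-identityˡ c ⟩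
      c                       ∎)
      where open ≡-Reasoning
    by-cases (no i≢s) (yes refl) = sym (begin
      addAt s c f t       ≡⟨ addAt-≢ c f i≢s ⟩
      + 𝟙≥ u (y' t)       ≡⟨ cong (λ v → + 𝟙≥ u v) transfer-at-t ⟩
      + 𝟙≥ u (y t + + 1)  ≡⟨ cong +_ (𝟙≥-no (ℤP.<-≤-trans yt+1<ys ys≤u)) ⟩
      + 0                 ≡⟨ cong +_ (sym (𝟙≥-no (ℤP.<-≤-trans yt<ys ys≤u))) ⟩
      + 𝟙≥ u (y t)        ∎)
      where open ≡-Reasoning
    by-cases (no i≢s) (no i≢t) =
      sym (trans (addAt-≢ c f i≢s) (cong (λ v → + 𝟙≥ u v) (transfer-elsewhere i≢s i≢t)))

  countAbove-transfer : ∀ u → y s ≤ u → countAbove y u ⊤ ≡ countAbove y' u ⊤ + + 𝟙≥ u (y s)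
  countAbove-transfer u ys≤u = begin
    countAbove y u ⊤
      ≡⟨ sumOn-cong ⊤ (λ i _ → 𝟙≥-transfer u ys≤u i) ⟩
    sumOn (addAt s (+ 𝟙≥ u (y s)) (λ j → + 𝟙≥ u (y' j))) ⊤
      ≡⟨ sumOn-addAt s _ _ ⊤ ⟩
    countAbove y' u ⊤ + when (lookup ⊤ s) (+ 𝟙≥ u (y s))
      ≡⟨ cong (λ b → countAbove y' u ⊤ + when b (+ 𝟙≥ u (y s))) (lookup-⊤ s) ⟩
    countAbove y' u ⊤ + + 𝟙≥ u (y s)  ∎
    where open ≡-Reasoning

  transfer-lex< : LexLeq (decSorted y') (decSorted y) × ¬ LexLeq (decSorted y) (decSorted y')
  transfer-lex< = lex<-from-count-drop (decSorted-descending y') (decSorted-descending y) (y s) agree drop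
    where
    agree : ∀ u → y s ℤ.< u → count≥ u (decSorted y') ≡ count≥ u (decSorted y)
    agree u ys<u = ℤP.+-injective (begin
      + count≥ u (decSorted y')         ≡⟨ count≥-decSorted y' u ⟩
      countAbove y' u ⊤                 ≡⟨ sym (ℤP.+-identityʳ _) ⟩
      countAbove y' u ⊤ + + 0           ≡⟨ cong (λ k → countAbove y' u ⊤ + + k) (sym (𝟙≥-no ys<u)) ⟩
      countAbove y' u ⊤ + + 𝟙≥ u (y s)  ≡⟨ sym (countAbove-transfer u (ℤP.<⇒≤ ys<u)) ⟩
      countAbove y u ⊤                  ≡⟨ sym (count≥-decSorted y u) ⟩
      + count≥ u (decSorted y)          ∎)
      where open ≡-Reasoning
    drop : count≥ (y s) (decSorted y') ℕ.< count≥ (y s) (decSorted y)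
    drop = ℕP.≤-reflexive (trans (ℕP.+-comm 1 _) (ℤP.+-injective (begin
      + (count≥ (y s) (decSorted y') ℕ.+ 1)
        ≡⟨ ℤP.pos-+ (count≥ (y s) (decSorted y')) 1 ⟩
      + count≥ (y s) (decSorted y') + + 1
        ≡⟨ cong₂ _+_ (count≥-decSorted y' (y s)) (cong +_ (sym (𝟙≥-yes (ℤP.≤-refl {y s})))) ⟩
      countAbove y' (y s) ⊤ + + 𝟙≥ (y s) (y s)
        ≡⟨ sym (countAbove-transfer (y s) ℤP.≤-refl) ⟩
      countAbove y (y s) ⊤
        ≡⟨ sym (count≥-decSorted y (y s)) ⟩
      + count≥ (y s) (decSorted y)  ∎)))
      where open ≡-Reasoning

  sumOfSquares-transfer : (+ 2 * (y s - y t) - + 2) + sumOfSquares y' ≡ sumOfSquares y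
  sumOfSquares-transfer = begin
    D + sumOfSquares y'
      ≡⟨ cong (_+_ D) (sumOfSquares-addAt t (+ 1) (addAt s (- + 1) y)) ⟩
    D + (sumOfSquares (addAt s (- + 1) y) + (+ 2 * + 1 * addAt s (- + 1) y t + + 1 * + 1))
      ≡⟨ cong₂ (λ Q v → D + (Q + (+ 2 * + 1 * v + + 1 * + 1)))
               (sumOfSquares-addAt s (- + 1) y) (addAt-≢ (- + 1) y (s≢t ∘ sym)) ⟩
    D + (sumOfSquares y + (+ 2 * - + 1 * y s + - + 1 * - + 1) + (+ 2 * + 1 * y t + + 1 * + 1))
      ≡⟨ lemma (sumOfSquares y) (y s) (y t) ⟩
    sumOfSquares y  ∎
    where
    open ≡-Reasoning
    D : ℤ
    D = + 2 * (y s - y t) - + 2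
    lemma : ∀ Q a b →
            (+ 2 * (a - b) - + 2) + (Q + (+ 2 * - + 1 * a + - + 1 * - + 1) + (+ 2 * + 1 * b + + 1 * + 1)) ≡ Q
    lemma = solve-∀

  sumOfSquares-decreases : sumOfSquares y' ℤ.< sumOfSquares y
  sumOfSquares-decreases = ℤP.suc[i]≤j⇒i<j
    (subst (+ 1 + sumOfSquares y' ≤_) sumOfSquares-transfer (ℤP.+-monoˡ-≤ (sumOfSquares y') 1≤D))
    where
    lemma : ∀ a b → (+ 2 * (a - b) - + 2) - + 1 ≡ + 2 * (a - (b + + 2)) + + 1
    lemma = solve-∀
    1≤D : + 1 ≤ + 2 * (y s - y t) - + 2
    1≤D = ≤-by-diff _ (lemma (y s) (y t))
            (ℤP.+-mono-≤ (ℤP.*-monoˡ-≤-nonNeg (+ 2) (ℤP.i≤j⇒0≤j-i gap)) (ℤ.+≤+ ℕ.z≤n))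

  ∣sumOfSquares∣-decreases : ℤ.∣ sumOfSquares y' ∣ ℕ.< ℤ.∣ sumOfSquares y ∣
  ∣sumOfSquares∣-decreases = ℤP.drop‿+<+
    (subst₂ ℤ._<_ (sym (+∣sumOfSquares∣ y')) (sym (+∣sumOfSquares∣ y)) sumOfSquares-decreases)

-- Integral points of the base polyhedron of a supermodular function

module BasePolyhedron {n : ℕ} (p : Subset n → ℤ∞) (p-super : Supermodular p) where

  InBase : (Fin n → ℤ) → Set
  InBase y = (p ⊤ ≡ fin (sumOn y ⊤)) × (∀ Z → p Z ≤∞ fin (sumOn y Z))

  InB⇒InBase : ∀ {y} → InB p y → InBase y
  InB⇒InBase {y} (total , lower) =
    subst (λ r → p ⊤ ≡ fin r) (tilde≡sumOn y ⊤) total ,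
    λ Z → subst (λ r → p Z ≤∞ fin r) (tilde≡sumOn y Z) (lower Z)

  InBase⇒InB : ∀ {y} → InBase y → InB p y
  InBase⇒InB {y} (total , lower) =
    subst (λ r → p ⊤ ≡ fin r) (sym (tilde≡sumOn y ⊤)) total ,
    λ Z → subst (λ r → p Z ≤∞ fin r) (sym (tilde≡sumOn y Z)) (lower Z)

  Tight : (Fin n → ℤ) → Subset n → Set
  Tight y Z = p Z ≡ fin (sumOn y Z)

  tight? : ∀ y Z → Dec (Tight y Z)
  tight? y Z with p Z
  ... | -∞    = no λ ()
  ... | fin a = Dec.map′ (cong fin) fin-injective (a ℤP.≟ sumOn y Z)
    where
    fin-injective : ∀ {a b} → fin a ≡ fin b → a ≡ b
    fin-injective refl = refl

  module _ {y : Fin n → ℤ} (y∈B : InBase y) where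

    tight-∪∩ : ∀ {X Y} → Tight y X → Tight y Y → Tight y (X ∪ Y) × Tight y (X ∩ Y)
    tight-∪∩ {X} {Y} X-tight Y-tight =
      let (∩-tight , ∪-tight) = +∞-squeeze bound (proj₂ y∈B (X ∩ Y)) (proj₂ y∈B (X ∪ Y)) in ∪-tight , ∩-tight
      where
      bound : fin (sumOn y (X ∩ Y) + sumOn y (X ∪ Y)) ≤∞ p (X ∩ Y) +∞ p (X ∪ Y)
      bound = subst (λ r → fin r ≤∞ p (X ∩ Y) +∞ p (X ∪ Y))
                (sym (trans (ℤP.+-comm (sumOn y (X ∩ Y)) (sumOn y (X ∪ Y))) (sumOn-∪+∩ y X Y)))
                (subst₂ (λ u v → u +∞ v ≤∞ p (X ∩ Y) +∞ p (X ∪ Y)) X-tight Y-tight (p-super X Y))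

    tight-⋂ : ∀ Zs → All (Tight y) Zs → Tight y (⋂ Zs)
    tight-⋂ []       []             = proj₁ y∈B
    tight-⋂ (Z ∷ Zs) (Z-tight ∷ ts) = proj₂ (tight-∪∩ Z-tight (tight-⋂ Zs ts))

    tight-⋃ : Tight y ⊥ → ∀ Zs → All (Tight y) Zs → Tight y (⋃ Zs)
    tight-⋃ ⊥-tight []       []             = ⊥-tight
    tight-⋃ ⊥-tight (Z ∷ Zs) (Z-tight ∷ ts) = proj₁ (tight-∪∩ Z-tight (tight-⋃ ⊥-tight Zs ts))

  Separated : (Fin n → ℤ) → Fin n → Fin n → Set
  Separated y s t = Σ[ Z ∈ Subset n ] Tight y Z × s ∈ Z × t ∉ Z

  separated? : ∀ y s t → Dec (Separated y s t)
  separated? y s t = SubsetP.anySubset? (λ Z → tight? y Z ×-dec s SubsetP.∈? Z ×-dec ¬? (t SubsetP.∈? Z))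

  transfer-InBase : ∀ {y s t} → InBase y → ¬ Separated y s t → InBase (transfer s t y)
  transfer-InBase {y} {s} {t} y∈B ¬sep =
    trans (proj₁ y∈B) (cong fin (sym total)) ,
    λ Z → subst (λ r → p Z ≤∞ fin r) (sym (sumOn-transfer s t y Z))
                (lower Z (lookup Z s) refl (lookup Z t) refl)
    where
    cancel : ∀ a → a + - + 1 + + 1 ≡ a
    cancel = solve-∀
    total : sumOn (transfer s t y) ⊤ ≡ sumOn y ⊤
    total = trans (sumOn-transfer s t y ⊤)
      (trans (cong₂ (λ a b → sumOn y ⊤ + when a (- + 1) + when b (+ 1)) (lookup-⊤ s) (lookup-⊤ t))
             (cancel (sumOn y ⊤)))
    lower : ∀ Z a → lookup Z s ≡ a → ∀ b → lookup Z t ≡ b →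
            p Z ≤∞ fin (sumOn y Z + when a (- + 1) + when b (+ 1))
    lower Z false _ b _ =
      ≤∞-trans (proj₂ y∈B Z) (≤-by-diff (when b (+ 1)) (lemma (sumOn y Z) (when b (+ 1))) (0≤when b))
      where
      lemma : ∀ a w → a + + 0 + w - a ≡ w
      lemma = solve-∀
      0≤when : ∀ b → + 0 ≤ when b (+ 1)
      0≤when true  = ℤ.+≤+ ℕ.z≤n
      0≤when false = ℤ.+≤+ ℕ.z≤n
    lower Z true _ true _ = subst (λ r → p Z ≤∞ fin r) (sym (cancel (sumOn y Z))) (proj₂ y∈B Z)
    lower Z true s∈Z false t∉Z = subst (λ r → p Z ≤∞ fin r) (lemma (sumOn y Z))
      (≤∞-pred (proj₂ y∈B Z) (λ Z-tight → ¬sep (Z , Z-tight , VecP.lookup⇒[]= s Z s∈Z ,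
        λ t∈Z → true≢false (trans (sym (VecP.[]=⇒lookup t∈Z)) t∉Z))))
      where
      lemma : ∀ a → a - + 1 ≡ a + - + 1 + + 0
      lemma = solve-∀
      true≢false : true ≢ false
      true≢false ()

  NoImprovingPair : (Fin n → ℤ) → Set
  NoImprovingPair y = ∀ s t → y t + + 2 ≤ y s → Separated y s t

  ImprovingPair : (Fin n → ℤ) → Set
  ImprovingPair y = Σ[ s ∈ Fin n ] Σ[ t ∈ Fin n ] (y t + + 2 ≤ y s) × ¬ Separated y s t

  improvingPair? : ∀ y → NoImprovingPair y ⊎ ImprovingPair y
  improvingPair? y with FinP.any? (λ s → FinP.any? (λ t → (y t + + 2 ℤP.≤? y s) ×-dec ¬? (separated? y s t)))
  ... | yes (s , t , gap , ¬sep) = inj₂ (s , t , gap , ¬sep)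
  ... | no  ∄pair = inj₁ λ s t gap →
    Dec.decidable-stable (separated? y s t) (λ ¬sep → ∄pair (s , t , gap , ¬sep))

  module _ {y : Fin n → ℤ} (y∈B : InBase y) (no-improving : NoImprovingPair y) where

    tightNeighbourhood : ∀ s → Σ[ Z ∈ Subset n ] Tight y Z × s ∈ Z × (∀ u → u ∈ Z → y s - + 1 ≤ y u)
    tightNeighbourhood s =
      ⋂ pieces ,
      tight-⋂ y∈B pieces (AllP.tabulate⁺ (λ u → proj₁ (proj₂ (piece u)))) ,
      x∈⋂⁺ (AllP.tabulate⁺ (λ u → proj₁ (proj₂ (proj₂ (piece u))))) ,
      λ u u∈ → proj₂ (proj₂ (proj₂ (piece u))) (AllP.tabulate⁻ (x∈⋂⁻ pieces u∈) u)
      where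
      piece : ∀ u → Σ[ Z ∈ Subset n ] Tight y Z × s ∈ Z × (u ∈ Z → y s - + 1 ≤ y u)
      piece u with y u + + 2 ℤP.≤? y s
      ... | yes gap  = let (Z , Z-tight , s∈Z , u∉Z) = no-improving s u gap in
                       Z , Z-tight , s∈Z , ⊥-elim ∘ u∉Z
      ... | no  ¬gap = ⊤ , proj₁ y∈B , SubsetP.∈⊤ , λ _ →
        ≤-by-diff _ (lemma (y u) (y s)) (ℤP.i≤j⇒0≤j-i (<⇒≤-1 (ℤP.≰⇒> ¬gap)))
        where
        lemma : ∀ a b → a - (b - + 1) ≡ (a + + 2 - + 1) - b
        lemma = solve-∀
      pieces : List (Subset n)
      pieces = tabulate (proj₁ ∘ piece)

  module CanonicalPartition (cp : Canonical p) (p⊥ : p ⊥ ≡ fin (+ 0)) where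
    open Canonical cp

    CanonicalRestrictions : (Fin n → ℤ) → Set
    CanonicalRestrictions m = ∀ j → j < q → InBi p Sp j m × InTi Sp β j m

    tight-⊥ : ∀ y → Tight y ⊥
    tight-⊥ y = trans p⊥ (cong fin (sym (sumOn-⊥ y)))

    module _ {y : Fin n → ℤ} (y∈B : InBase y) (no-improving : NoImprovingPair y) where

      module Level (j : ℕ) (j<q : j < q) (C-tight : Tight y (chain Sp j)) where

        C R : Subset n
        C = chain Sp j
        R = ⊤ ─ C

        ∉C⇒∈R : ∀ {s} → s ∉ C → s ∈ R
        ∉C⇒∈R = SubsetP.x∈p∧x∉q⇒x∈p─q SubsetP.∈⊤

        ∈R⇒∉C : ∀ {s} → s ∈ R → s ∉ C
        ∈R⇒∉C s∈R = proj₂ (x∈p─q⁻ ⊤ C s∈R)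

        ─C⊆R : ∀ Y → Y ─ C ⊆ R
        ─C⊆R Y u∈ = ∉C⇒∈R (proj₂ (x∈p─q⁻ Y C u∈))

        sumOn-∪C : ∀ {X} → X ⊆ R → sumOn y (X ∪ C) ≡ sumOn y X + sumOn y C
        sumOn-∪C {X} X⊆R = sumOn-∪-disjoint y X C (∈R⇒∉C ∘ X⊆R)

        shift-≡ : ∀ X → shift p C X ≡ p (X ∪ C) ⊖∞ fin (sumOn y C)
        shift-≡ X = cong (p (X ∪ C) ⊖∞_) C-tight

        shift-≤ : ∀ {X} → X ⊆ R → shift p C X ≤∞ fin (sumOn y X)
        shift-≤ {X} X⊆R = subst₂ _≤∞_ (sym (shift-≡ X)) (cong fin (i+j-j≡i (sumOn y X) (sumOn y C)))
                            (⊖∞-≤ (subst (λ r → p (X ∪ C) ≤∞ fin r) (sumOn-∪C X⊆R) (proj₂ y∈B (X ∪ C))))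

        shift-tight : ∀ {X} → X ⊆ R → Tight y (X ∪ C) → shift p C X ≡ fin (sumOn y X)
        shift-tight {X} X⊆R XC-tight = begin
          shift p C X                               ≡⟨ shift-≡ X ⟩
          p (X ∪ C) ⊖∞ fin (sumOn y C)              ≡⟨ cong (_⊖∞ fin (sumOn y C)) XC-tight ⟩
          fin (sumOn y (X ∪ C) - sumOn y C)         ≡⟨ cong (λ r → fin (r - sumOn y C)) (sumOn-∪C X⊆R) ⟩
          fin (sumOn y X + sumOn y C - sumOn y C)   ≡⟨ cong fin (i+j-j≡i (sumOn y X) (sumOn y C)) ⟩
          fin (sumOn y X)                           ∎
          where open ≡-Reasoning

        shift-tight-─C : ∀ {Y} → Tight y Y → C ⊆ Y → shift p C (Y ─ C) ≡ fin (sumOn y (Y ─ C))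
        shift-tight-─C {Y} Y-tight C⊆Y =
          shift-tight (─C⊆R Y) (subst (Tight y) (sym (─∪-cancel C⊆Y)) Y-tight)

        tight-from-shift : ∀ {X} → X ⊆ R → fin (sumOn y X) ≤∞ shift p C X → Tight y (X ∪ C)
        tight-from-shift {X} X⊆R lower = ≤∞-antisym (proj₂ y∈B (X ∪ C))
          (subst (λ r → fin r ≤∞ p (X ∪ C)) (sym (sumOn-∪C X⊆R))
            (⊖∞-≥ (subst₂ _≤∞_ (cong fin (sym (i+j-j≡i (sumOn y X) (sumOn y C)))) (shift-≡ X) lower)))

        -- Otherwise the tight neighbourhood of s, minus C_j, would have average value above β_j.
        ≤β : ∀ {s} → s ∉ C → y s ≤ β j
        ≤β {s} s∉C with tightNeighbourhood y∈B no-improving s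
        ... | (Z , Z-tight , s∈Z , near) =
          ≤∞-trans {fin (y s)} {fin (ceilDiv (sumOn y X) ∣ X ∣)}
            (≤-ceilDiv-mean y s∈X (λ u u∈X → near u (X⊆Z u∈X)))
            (subst (λ v → ceilDiv∞ v ∣ X ∣ ≤∞ fin (β j)) (shift-tight-─C Y-tight (SubsetP.q⊆p∪q Z C))
              (β-upper j j<q X (s , s∈X) (─C⊆R (Z ∪ C))))
          where
          X : Subset n
          X = (Z ∪ C) ─ C
          Y-tight : Tight y (Z ∪ C)
          Y-tight = proj₁ (tight-∪∩ y∈B Z-tight C-tight)
          s∈X : s ∈ X
          s∈X = SubsetP.x∈p∧x∉q⇒x∈p─q (SubsetP.p⊆p∪q C s∈Z) s∉C
          X⊆Z : X ⊆ Z
          X⊆Z u∈X with x∈p─q⁻ (Z ∪ C) C u∈X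
          ... | (u∈Y , u∉C) with SubsetP.x∈p∪q⁻ Z C u∈Y
          ...   | inj₁ u∈Z = u∈Z
          ...   | inj₂ u∈C = ⊥-elim (u∉C u∈C)

        record TopPiece (v : Fin n) : Set where
          field
            set     : Subset n
            tight   : Tight y set
            above   : ∀ u → u ∈ set → β j - + 1 ≤ y u
            ∋-at-β  : y v ≡ β j → v ∈ set

        topPiece : ∀ v → TopPiece v
        topPiece v with β j ℤP.≤? y v | tightNeighbourhood y∈B no-improving v
        ... | yes β≤yv | (Z , Z-tight , v∈Z , near) = record
          { set = Z ; tight = Z-tight ; ∋-at-β = λ _ → v∈Z
          ; above = λ u u∈Z → ℤP.≤-trans (ℤP.+-monoˡ-≤ (- + 1) β≤yv) (near u u∈Z) }
        ... | no  β≰yv | _ = record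
          { set = ⊥ ; tight = tight-⊥ y ; ∋-at-β = λ yv≡β → ⊥-elim (β≰yv (ℤP.≤-reflexive (sym yv≡β)))
          ; above = λ u u∈⊥ → ⊥-elim (SubsetP.∉⊥ u∈⊥) }

        topPieces : List (Subset n)
        topPieces = tabulate (TopPiece.set ∘ topPiece)

        Top : Subset n
        Top = C ∪ ⋃ topPieces

        Top-tight : Tight y Top
        Top-tight = proj₁ (tight-∪∩ y∈B C-tight
          (tight-⋃ y∈B (tight-⊥ y) topPieces (AllP.tabulate⁺ (TopPiece.tight ∘ topPiece))))

        Top-above : ∀ u → u ∈ Top → u ∉ C → β j - + 1 ≤ y u
        Top-above u u∈Top u∉C with SubsetP.x∈p∪q⁻ C (⋃ topPieces) u∈Top
        ... | inj₁ u∈C = ⊥-elim (u∉C u∈C)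
        ... | inj₂ u∈⋃ with AnyP.tabulate⁻ (x∈⋃⁻ topPieces u∈⋃)
        ...   | (v , u∈piece) = TopPiece.above (topPiece v) u u∈piece

        Top-∋β : ∀ u → y u ≡ β j → u ∈ Top
        Top-∋β u yu≡β = SubsetP.q⊆p∪q C (⋃ topPieces) (x∈⋃⁺ (AnyP.tabulate⁺ u (TopPiece.∋-at-β (topPiece u) yu≡β)))

        W : Subset n
        W = Top ─ C

        g g⁺ : Fin n → ℤ
        g u = y u - (β j - + 1)
        g⁺ u = g u ⊔ + 0

        hfun-≤ : ∀ {X} → X ⊆ R → hfun p C (β j) X ≤∞ fin (sumOn g X)
        hfun-≤ {X} X⊆R = subst (λ r → hfun p C (β j) X ≤∞ fin r) (sym (sumOn-shift y (β j - + 1) X))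
                               (⊖∞-≤ (shift-≤ X⊆R))

        sumOn-g≤ : ∀ {X} → X ⊆ R → sumOn g X ≤ sumOn g⁺ R
        sumOn-g≤ {X} X⊆R = ℤP.≤-trans (sumOn-mono-≤ X (λ u _ → ℤP.i≤i⊔j (g u) (+ 0)))
                                      (sumOn-mono-⊆ (λ u _ → ℤP.i≤j⊔i (g u) (+ 0)) X⊆R)

        -- As y ≤ β_j on R, g⁺ vanishes on R off the elements of value β_j; these all lie in W, and g ≥ 0 on W.
        hfun-W : hfun p C (β j) W ≡ fin (sumOn g⁺ R)
        hfun-W = trans (cong (_⊖∞ fin ((β j - + 1) * + ∣ W ∣)) (shift-tight-─C Top-tight C⊆Top)) (cong fin (begin
            sumOn y W - (β j - + 1) * + ∣ W ∣  ≡⟨ sym (sumOn-shift y (β j - + 1) W) ⟩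
            sumOn g W                         ≡⟨ sumOn-cong W (λ u u∈W → sym (ℤP.i≥j⇒i⊔j≡i (0≤g u∈W))) ⟩
            sumOn g⁺ W                        ≡⟨ sumOn-vanishing (─C⊆R Top) vanish ⟩
            sumOn g⁺ R                        ∎))
          where
          open ≡-Reasoning
          C⊆Top : C ⊆ Top
          C⊆Top = SubsetP.p⊆p∪q (⋃ topPieces)
          0≤g : ∀ {u} → u ∈ W → + 0 ≤ g u
          0≤g {u} u∈W = let (u∈Top , u∉C) = x∈p─q⁻ Top C u∈W in ℤP.i≤j⇒0≤j-i (Top-above u u∈Top u∉C)
          vanish : ∀ u → u ∈ R → u ∉ W → g⁺ u ≡ + 0
          vanish u u∈R u∉W = ℤP.i≤j⇒i⊔j≡j (ℤP.i≤j⇒i-j≤0 (<⇒≤-1 (ℤP.≤∧≢⇒< (≤β (∈R⇒∉C u∈R)) yu≢β)))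
            where
            yu≢β : y u ≢ β j
            yu≢β yu≡β = u∉W (SubsetP.x∈p∧x∉q⇒x∈p─q (Top-∋β u yu≡β) (∈R⇒∉C u∈R))

        S⊆R : Sp j ⊆ R
        S⊆R = S-sub j j<q

        S⊆W : Sp j ⊆ W
        S⊆W = S-least j j<q W (─C⊆R Top) λ X X⊆R →
          subst (hfun p C (β j) X ≤∞_) (sym hfun-W) (≤∞-trans (hfun-≤ X⊆R) (sumOn-g≤ X⊆R))

        S∪C-tight : Tight y (Sp j ∪ C)
        S∪C-tight = tight-from-shift S⊆R (⊖∞-≥ (≤∞-trans {fin excess} {fin (sumOn g⁺ R)} excess≤max max≤h))
          where
          excess : ℤ
          excess = sumOn y (Sp j) - (β j - + 1) * + ∣ Sp j ∣
          excess≤max : excess ≤ sumOn g⁺ R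
          excess≤max = subst (_≤ sumOn g⁺ R) (sumOn-shift y (β j - + 1) (Sp j)) (sumOn-g≤ S⊆R)
          max≤h : fin (sumOn g⁺ R) ≤∞ hfun p C (β j) (Sp j)
          max≤h = subst (_≤∞ hfun p C (β j) (Sp j)) hfun-W (S-max j j<q W (─C⊆R Top))

        inTi : InTi Sp β j y
        inTi s s∈S = let (s∈Top , s∉C) = x∈p─q⁻ Top C (S⊆W s∈S) in Top-above s s∈Top s∉C , ≤β s∉C

        inBi : InBi p Sp j y
        inBi = subst (λ r → shift p C (Sp j) ≡ fin r) (sym (tilde≡sumOn y (Sp j))) (shift-tight S⊆R S∪C-tight) ,
               λ Z Z⊆S → subst (λ r → shift p C Z ≤∞ fin r) (sym (tilde≡sumOn y Z)) (shift-≤ (S⊆R ∘ Z⊆S))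

      chain-tight : ∀ j → j ℕ.≤ q → Tight y (chain Sp j)
      chain-tight zero    _   = tight-⊥ y
      chain-tight (suc j) j<q = subst (Tight y) (SubsetP.∪-comm (Sp j) (chain Sp j))
        (Level.S∪C-tight j j<q (chain-tight j (ℕP.<⇒≤ j<q)))

      restrictions : CanonicalRestrictions y
      restrictions j j<q = Level.inBi j j<q C-tight , Level.inTi j j<q C-tight
        where
        C-tight : Tight y (chain Sp j)
        C-tight = chain-tight j (ℕP.<⇒≤ j<q)

    sumOn-Sp-≡ : ∀ {x y} → CanonicalRestrictions x → CanonicalRestrictions y →
                 ∀ i → i < q → sumOn x (Sp i) ≡ sumOn y (Sp i)
    sumOn-Sp-≡ {x} {y} xR yR i i<q = begin
      sumOn x (Sp i)  ≡⟨ sym (tilde≡sumOn x (Sp i)) ⟩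
      tilde x (Sp i)  ≡⟨ fin-injective (trans (sym (proj₁ (proj₁ (xR i i<q)))) (proj₁ (proj₁ (yR i i<q)))) ⟩
      tilde y (Sp i)  ≡⟨ tilde≡sumOn y (Sp i) ⟩
      sumOn y (Sp i)  ∎
      where
      open ≡-Reasoning
      fin-injective : ∀ {a b} → fin a ≡ fin b → a ≡ b
      fin-injective refl = refl

    countAbove-chain : ∀ {x y} → CanonicalRestrictions x → CanonicalRestrictions y →
                       ∀ t i → i ℕ.≤ q → countAbove x t (chain Sp i) ≡ countAbove y t (chain Sp i)
    countAbove-chain {x} {y} _  _  t zero    _   =
      trans (sumOn-⊥ (λ i → + 𝟙≥ t (x i))) (sym (sumOn-⊥ (λ i → + 𝟙≥ t (y i))))
    countAbove-chain {x} {y} xR yR t (suc i) i<q = begin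
      countAbove x t (chain Sp i ∪ Sp i)
        ≡⟨ sumOn-∪-disjoint _ (chain Sp i) (Sp i) disjoint ⟩
      countAbove x t (chain Sp i) + countAbove x t (Sp i)
        ≡⟨ cong₂ _+_ (countAbove-chain xR yR t i (ℕP.<⇒≤ i<q))
                     (countAbove-band (proj₂ (xR i i<q)) (proj₂ (yR i i<q)) (sumOn-Sp-≡ xR yR i i<q) t) ⟩
      countAbove y t (chain Sp i) + countAbove y t (Sp i)
        ≡⟨ sym (sumOn-∪-disjoint _ (chain Sp i) (Sp i) disjoint) ⟩
      countAbove y t (chain Sp i ∪ Sp i)  ∎
      where
      open ≡-Reasoning
      disjoint : ∀ {u} → u ∈ chain Sp i → u ∉ Sp i
      disjoint u∈C u∈S = proj₂ (x∈p─q⁻ ⊤ (chain Sp i) (S-sub i i<q u∈S)) u∈C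

    count≥-restrictions : ∀ {x y} → CanonicalRestrictions x → CanonicalRestrictions y →
                          ∀ t → count≥ t (decSorted x) ≡ count≥ t (decSorted y)
    count≥-restrictions {x} {y} xR yR t = ℤP.+-injective (begin
      + count≥ t (decSorted x)  ≡⟨ count≥-decSorted x t ⟩
      countAbove x t ⊤          ≡⟨ subst (λ Z → countAbove x t Z ≡ countAbove y t Z) stops
                                         (countAbove-chain xR yR t q ℕP.≤-refl) ⟩
      countAbove y t ⊤          ≡⟨ sym (count≥-decSorted y t) ⟩
      + count≥ t (decSorted y)  ∎)
      where open ≡-Reasoning

    decMin⇒restrictions : ∀ {m} → InBase m → DecMin (InB p) m → CanonicalRestrictions m
    decMin⇒restrictions {m} m∈B (_ , minimal) = restrictions m∈B no-improving
      where
      no-improving : NoImprovingPair m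
      no-improving s t gap with separated? m s t
      ... | yes sep  = sep
      ... | no  ¬sep =
        ⊥-elim (proj₂ (Transfer.transfer-lex< m gap) (minimal _ (InBase⇒InB (transfer-InBase m∈B ¬sep))))

    restrictions⇒decMin : ∀ {m} → InBase m → CanonicalRestrictions m → DecMin (InB p) m
    restrictions⇒decMin {m} m∈B mR = InBase⇒InB m∈B , λ y y∈B → lex-below y (<-wellFounded _) (InB⇒InBase y∈B)
      where
      lex-below : ∀ y → Acc ℕ._<_ ℤ.∣ sumOfSquares y ∣ → InBase y → LexLeq (decSorted m) (decSorted y)
      lex-below y (acc smaller) y∈B with improvingPair? y
      ... | inj₁ no-improving =
        lex-from-counts (decSorted m) (decSorted y) (decSorted-descending m) (decSorted-descending y)
          (λ t _ → ℕP.≤-reflexive (count≥-restrictions mR (restrictions y∈B no-improving) t))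
      ... | inj₂ (s , t , gap , ¬sep) =
        LexLeq-trans (decSorted m) (decSorted (transfer s t y)) (decSorted y)
          (lex-below (transfer s t y) (smaller (Transfer.∣sumOfSquares∣-decreases y gap)) (transfer-InBase y∈B ¬sep))
          (proj₁ (Transfer.transfer-lex< y gap))

theorem5p1 : (k : ℕ) (p : Subset (suc k) → ℤ∞) →
    Supermodular p → p ⊥ ≡ fin (+ 0) → Σ ℤ (λ c → p ⊤ ≡ fin c) →
    (cp : Canonical p) → (m : Fin (suc k) → ℤ) → InB p m →
    (DecMin (InB p) m ⇔
      (∀ j → j < Canonical.q cp →
        InBi p (Canonical.Sp cp) j m × InTi (Canonical.Sp cp) (Canonical.β cp) j m))
theorem5p1 k p p-super p⊥ _ cp m m∈B =  -- finiteness of p(S) follows from m ∈ B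
  mk⇔ (decMin⇒restrictions (InB⇒InBase m∈B)) (restrictions⇒decMin (InB⇒InBase m∈B))
  where
  open BasePolyhedron p p-super
  open CanonicalPartition cp p⊥
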